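{- Let $L$ be a transitive permutation group of degree $\ell$. Then $L$ has at most $\ell^{\log_2(\ell)}$ systems of imprimitivity. -}

module Defs where

open import Data.Nat using (ℕ; _≤_; _<_; _^_; _*_)
open import Data.Bool using (Bool; true)
open import Data.Fin using (Fin)
open import Data.Fin.Permutation using (Permutation′; _⟨$⟩ʳ_; id; flip; _∘ₚ_; _≈_)
open import Data.List using (List; length)
open import Data.List.Relation.Unary.All using (All)
open import Data.List.Relation.Unary.AllPairs using (AllPairs)
open import Data.Product using (Σ; ∃; ∃-syntax; _×_)
open import Relation.Binary.PropositionalEquality using (_≡_; _≢_)

record PermGroup (ℓ : ℕ) : Set₁ where
  field
    _∈L : Permutation′ ℓ → Set
    ∈-resp-≈ : ∀ {g h} → g ≈ h → g ∈L → h ∈L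
    id-∈ : id ∈L
    ∘-∈ : ∀ {g h} → g ∈L → h ∈L → (g ∘ₚ h) ∈L
    inv-∈ : ∀ {g} → g ∈L → flip g ∈L

open PermGroup public

Transitive : ∀ {ℓ} → PermGroup ℓ → Set
Transitive {ℓ} L = ∀ (i j : Fin ℓ) → ∃[ g ] ((_∈L L g) × (g ⟨$⟩ʳ i ≡ j))

BRel : ℕ → Set
BRel ℓ = Fin ℓ → Fin ℓ → Bool

IsEquivalenceB : ∀ {ℓ} → BRel ℓ → Set
IsEquivalenceB {ℓ} R =
  (∀ i → R i i ≡ true) ×
  (∀ i j → R i j ≡ true → R j i ≡ true) ×
  (∀ i j k → R i j ≡ true → R j k ≡ true → R i k ≡ true)

-- A system of imprimitivity (block system) for L: an L-invariant partition of
-- Fin ℓ, represented by its equivalence relation.  Trivial systems included.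
SystemOfImprimitivity : ∀ {ℓ} → PermGroup ℓ → BRel ℓ → Set
SystemOfImprimitivity {ℓ} L R =
  IsEquivalenceB R ×
  (∀ g → _∈L L g → ∀ i j → R i j ≡ true → R (g ⟨$⟩ʳ i) (g ⟨$⟩ʳ j) ≡ true)

DifferentB : ∀ {ℓ} → BRel ℓ → BRel ℓ → Set
DifferentB {ℓ} R S = ∃[ i ] ∃[ j ] (R i j ≢ S i j)

-- "N ≤ ℓ ^ (log₂ ℓ)" (real logarithm), expressed over ℕ for ℓ ≥ 1:
-- N ≤ 2^((log₂ ℓ)²) iff for every rational p/q (q > 0) with p/q ≥ log₂ ℓ,
-- i.e. ℓ^q ≤ 2^p, we have log₂ N ≤ (p/q)², i.e. N^(q·q) ≤ 2^(p·p).
AtMostPowLog2 : ℕ → ℕ → Set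
AtMostPowLog2 N ℓ = ∀ (p q : ℕ) → 0 < q → ℓ ^ q ≤ 2 ^ p → N ^ (q * q) ≤ 2 ^ (p * p)

AtMostPowLog2Systems : ∀ {ℓ} → PermGroup ℓ → Set
AtMostPowLog2Systems {ℓ} L =
  ∀ (Rs : List (BRel ℓ)) →
    All (SystemOfImprimitivity L) Rs →
    AllPairs DifferentB Rs →
    AtMostPowLog2 (length Rs) ℓ

module Submission where

-- Fix a base point o.  For a transitive group L, a system of
-- imprimitivity R is determined by its block R o through o (every point can
-- be moved to o).  Given a list Rs of systems and a list x of points, the
-- "hull" of x is the intersection of those systems in Rs whose o-block
-- contains x; it is again a system of imprimitivity.  If R ∈ Rs is not yet
-- generated by x, i.e. some y ∈ R o is missing from the hull's o-block, then
-- adding y at least doubles the o-block of the hull, since a translate of the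
-- old block through y is disjoint from it and lies in the new one.  Blocks have
-- at most ℓ points, so with 2 ^ k ≤ ℓ < 2 ^ (k + 1) every R ∈ Rs is generated
-- by a k-tuple of points.  Distinct systems get distinct tuples, hence at most
-- ℓ ^ k ≤ ℓ ^ (log₂ ℓ) systems; the last step is a computation with the
-- rational approximations of log₂ ℓ used in Defs.

open import Defs
open import Data.Nat using (ℕ; zero; suc; _≤_; _<_; _+_; _*_; _^_; z≤n; s≤s)
open import Data.Nat.Properties
open import Data.Bool using (Bool; true; false; _∧_; _∨_)
open import Data.Bool.Properties using (∧-conicalˡ; ∧-conicalʳ)
open import Data.Fin using (Fin; combine) renaming (zero to fzero; suc to fsuc; _<_ to _<ᶠ_)
open import Data.Fin.Properties using (any?; pigeonhole; combine-injective)
open import Data.Fin.Permutation using (Permutation′; _⟨$⟩ʳ_; flip; inverseˡ)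
open import Data.List using (List; []; _∷_; _++_; [_]; length; lookup)
open import Data.Bool.ListAction using (all)
open import Data.List.Properties using (++-assoc)
open import Data.List.Relation.Unary.All as All using (All; []; _∷_)
open import Data.List.Relation.Unary.Any using (here; there)
open import Data.List.Relation.Unary.AllPairs using (AllPairs; _∷_)
open import Data.List.Membership.Propositional using (_∈_)
open import Data.List.Membership.Propositional.Properties using (∈-lookup; ∈-++⁺ʳ)
open import Data.Vec.Functional using (removeAt)
open import Data.Vec using (Vec; toList; replicate) renaming ([] to []ᵛ; _∷_ to _∷ᵛ_)
open import Data.Product using (Σ; ∃; ∃-syntax; _×_; _,_; proj₁; proj₂)
open import Data.Empty using (⊥-elim)
open import Relation.Nullary using (¬_; Dec; yes; no)
open import Relation.Binary.PropositionalEquality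
  using (_≡_; refl; sym; trans; cong; cong₂; subst; subst₂; module ≡-Reasoning)
open import Algebra.Properties.CommutativeMonoid.Sum +-0-commutativeMonoid
  using (sum; sum-permute; ∑-distrib-+; sum-remove)

Holds : Bool → Set
Holds b = b ≡ true

bool-ext : ∀ {a b} → (Holds a → Holds b) → (Holds b → Holds a) → a ≡ b
bool-ext {true}  {true}  _ _ = refl
bool-ext {true}  {false} f _ = sym (f refl)
bool-ext {false} {true}  _ g = g refl
bool-ext {false} {false} _ _ = refl

-- Boolean implication; it restricts an intersection to selected systems.
_⇒ᵇ_ : Bool → Bool → Bool
true  ⇒ᵇ b = b
false ⇒ᵇ _ = true

⇒ᵇ-intro : ∀ a {b} → (Holds a → Holds b) → Holds (a ⇒ᵇ b)
⇒ᵇ-intro true  f = f refl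
⇒ᵇ-intro false _ = refl

⇒ᵇ-elim : ∀ a {b} → Holds (a ⇒ᵇ b) → Holds a → Holds b
⇒ᵇ-elim true  p _ = p

indicator : Bool → ℕ
indicator true  = 1
indicator false = 0

count : ∀ {n} → (Fin n → Bool) → ℕ
count P = sum (λ j → indicator (P j))

sum-mono-≤ : ∀ {n} {f g : Fin n → ℕ} → (∀ i → f i ≤ g i) → sum f ≤ sum g
sum-mono-≤ {zero}  _   = z≤n
sum-mono-≤ {suc n} f≤g = +-mono-≤ (f≤g fzero) (sum-mono-≤ (λ i → f≤g (fsuc i)))

sum-ones : ∀ n → sum {n} (λ _ → 1) ≡ n
sum-ones zero    = refl
sum-ones (suc n) = cong suc (sum-ones n)

indicator-mono : ∀ {a b} → (Holds a → Holds b) → indicator a ≤ indicator b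
indicator-mono {false} _ = z≤n
indicator-mono {true}  f rewrite f refl = ≤-refl

indicator-≤1 : ∀ a → indicator a ≤ 1
indicator-≤1 true  = ≤-refl
indicator-≤1 false = z≤n

indicator-disjoint : ∀ a b → (Holds a → b ≡ false) → indicator a + indicator b ≤ indicator (a ∨ b)
indicator-disjoint true  b disjoint rewrite disjoint refl = ≤-refl
indicator-disjoint false b _ = ≤-refl

count-mono : ∀ {n} {P Q : Fin n → Bool} → (∀ j → Holds (P j) → Holds (Q j)) → count P ≤ count Q
count-mono P⊆Q = sum-mono-≤ (λ j → indicator-mono (P⊆Q j))

count-≤ : ∀ {n} (P : Fin n → Bool) → count P ≤ n
count-≤ {n} P = ≤-trans (sum-mono-≤ (λ j → indicator-≤1 (P j))) (≤-reflexive (sum-ones n))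

count-pos : ∀ {n} (P : Fin n → Bool) j → Holds (P j) → 1 ≤ count P
count-pos {suc n} P j Pj = begin
  1                                                         ≡⟨ cong indicator (sym Pj) ⟩
  indicator (P j)                                           ≤⟨ m≤m+n _ _ ⟩
  indicator (P j) + sum (removeAt (λ i → indicator (P i)) j) ≡⟨ sym (sum-remove {i = j} (λ i → indicator (P i))) ⟩
  count P                                                   ∎
  where open ≤-Reasoning

count-disjoint : ∀ {n} (P Q : Fin n → Bool) → (∀ j → Holds (P j) → Q j ≡ false) →
                 count P + count Q ≤ count (λ j → P j ∨ Q j)
count-disjoint P Q disjoint = begin
  count P + count Q                                 ≡⟨ sym (∑-distrib-+ (λ j → indicator (P j)) (λ j → indicator (Q j))) ⟩
  sum (λ j → indicator (P j) + indicator (Q j))     ≤⟨ sum-mono-≤ (λ j → indicator-disjoint (P j) (Q j) (disjoint j)) ⟩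
  count (λ j → P j ∨ Q j)                           ∎
  where open ≤-Reasoning

count-perm : ∀ {n} (Q : Fin n → Bool) (g : Permutation′ n) → count (λ j → Q (g ⟨$⟩ʳ j)) ≡ count Q
count-perm Q g = sym (sum-permute (λ j → indicator (Q j)) g)

doubling-invariant : ∀ {n a a' b} → n < a * (2 * b) → 2 * a ≤ a' → n < a' * b
doubling-invariant {n} {a} {a'} {b} n<a·2b 2a≤a' = <-≤-trans n<a·2b (begin
  a * (2 * b)  ≡⟨ sym (*-assoc a 2 b) ⟩
  a * 2 * b    ≡⟨ cong (_* b) (*-comm a 2) ⟩
  2 * a * b    ≤⟨ *-monoˡ-≤ b 2a≤a' ⟩
  a' * b       ∎)
  where open ≤-Reasoning

floor-log₂ : ∀ n → ∃[ k ] (2 ^ k ≤ suc n × suc n < 2 ^ suc k)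
floor-log₂ zero = 0 , ≤-refl , s≤s (s≤s z≤n)
floor-log₂ (suc n) with floor-log₂ n
... | k , lower , upper with suc (suc n) <? 2 ^ suc k
...   | yes upper′ = k , m≤n⇒m≤1+n lower , upper′
...   | no ¬upper′ = suc k , ≤-reflexive (sym 2+n≡2^[1+k]) , upper″
  where
  2+n≡2^[1+k] : suc (suc n) ≡ 2 ^ suc k
  2+n≡2^[1+k] = ≤-antisym upper (≮⇒≥ ¬upper′)
  upper″ : suc (suc n) < 2 ^ suc (suc k)
  upper″ = subst (_< 2 ^ suc (suc k)) (sym 2+n≡2^[1+k]) (^-monoʳ-< 2 (s≤s (s≤s z≤n)) (n<1+n (suc k)))

2^-reflects-≤ : ∀ {a b} → 2 ^ a ≤ 2 ^ b → a ≤ b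
2^-reflects-≤ 2^a≤2^b = ≮⇒≥ (λ b<a → <⇒≱ (^-monoʳ-< 2 (s≤s (s≤s z≤n)) b<a) 2^a≤2^b)

-- If N ≤ ℓ ^ k for some k with 2 ^ k ≤ ℓ, then N ≤ ℓ ^ (log₂ ℓ) in the sense of
-- Defs: for every rational bound p/q ≥ log₂ ℓ we have k ≤ p/q, hence
-- N ^ (q·q) ≤ ℓ ^ (k·q·q) ≤ 2 ^ (p·k·q) ≤ 2 ^ (p·p).
atMostPowLog2-from : ∀ N ℓ k → N ≤ ℓ ^ k → 2 ^ k ≤ ℓ → AtMostPowLog2 N ℓ
atMostPowLog2-from N ℓ k N≤ℓ^k 2^k≤ℓ p q _ ℓ^q≤2^p = begin
    N ^ (q * q)        ≤⟨ ^-monoˡ-≤ (q * q) N≤ℓ^k ⟩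
    (ℓ ^ k) ^ (q * q)  ≡⟨ ^-*-assoc ℓ k (q * q) ⟩
    ℓ ^ (k * (q * q))  ≡⟨ cong (ℓ ^_) (trans (sym (*-assoc k q q)) (*-comm (k * q) q)) ⟩
    ℓ ^ (q * (k * q))  ≡⟨ sym (^-*-assoc ℓ q (k * q)) ⟩
    (ℓ ^ q) ^ (k * q)  ≤⟨ ^-monoˡ-≤ (k * q) ℓ^q≤2^p ⟩
    (2 ^ p) ^ (k * q)  ≡⟨ ^-*-assoc 2 p (k * q) ⟩
    2 ^ (p * (k * q))  ≤⟨ ^-monoʳ-≤ 2 (*-monoʳ-≤ p kq≤p) ⟩
    2 ^ (p * p)        ∎
  where
  open ≤-Reasoning
  kq≤p : k * q ≤ p
  kq≤p = 2^-reflects-≤ (begin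
    2 ^ (k * q)  ≡⟨ sym (^-*-assoc 2 k q) ⟩
    (2 ^ k) ^ q  ≤⟨ ^-monoˡ-≤ q 2^k≤ℓ ⟩
    ℓ ^ q        ≤⟨ ℓ^q≤2^p ⟩
    2 ^ p        ∎)

encode : ∀ {ℓ k} → Vec (Fin ℓ) k → Fin (ℓ ^ k)
encode []ᵛ       = fzero
encode (a ∷ᵛ v) = combine a (encode v)

encode-injective : ∀ {ℓ k} (u v : Vec (Fin ℓ) k) → encode u ≡ encode v → u ≡ v
encode-injective []ᵛ []ᵛ _ = refl
encode-injective (a ∷ᵛ u) (b ∷ᵛ v) eq with combine-injective a (encode u) b (encode v) eq
... | refl , eq′ = cong (a ∷ᵛ_) (encode-injective u v eq′)

allPairs-lookup : ∀ {A : Set} {D : A → A → Set} {xs : List A} → AllPairs D xs →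
                  ∀ {i j} → i <ᶠ j → D (lookup xs i) (lookup xs j)
allPairs-lookup (Dx ∷ _)   {fzero}  {fsuc j} _         = All.lookup Dx (∈-lookup j)
allPairs-lookup (_ ∷ Dxs) {fsuc i} {fsuc j} (s≤s i<j) = allPairs-lookup Dxs i<j

pairwise-bound : ∀ {A : Set} {D : A → A → Set} {M} (xs : List A) → AllPairs D xs →
                 (code : Fin (length xs) → Fin M) →
                 (∀ i j → code i ≡ code j → ¬ D (lookup xs i) (lookup xs j)) →
                 length xs ≤ M
pairwise-bound {M = M} xs related code separates = ≮⇒≥ collision
  where
  collision : ¬ M < length xs
  collision M<length with pigeonhole M<length code
  ... | i , j , i<j , same-code = separates i j same-code (allPairs-lookup related i<j)

module BlockSystems {ℓ : ℕ} (L : PermGroup ℓ) (transitive : Transitive L) (o : Fin ℓ) where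

  IsSystem : BRel ℓ → Set
  IsSystem = SystemOfImprimitivity L

  system-refl : ∀ {R} → IsSystem R → ∀ i → Holds (R i i)
  system-refl ((r , _ , _) , _) = r

  system-sym : ∀ {R} → IsSystem R → ∀ i j → Holds (R i j) → Holds (R j i)
  system-sym ((_ , s , _) , _) = s

  system-trans : ∀ {R} → IsSystem R → ∀ i j k → Holds (R i j) → Holds (R j k) → Holds (R i k)
  system-trans ((_ , _ , t) , _) = t

  system-invariant : ∀ {R} → IsSystem R → ∀ g → _∈L L g → ∀ i j → Holds (R i j) →
                     Holds (R (g ⟨$⟩ʳ i) (g ⟨$⟩ʳ j))
  system-invariant (_ , inv) = inv

  -- Inclusion of blocks at o implies inclusion of the systems: move i to o by
  -- some g ∈ L, compare there, and move back with g⁻¹.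
  block-⊆⇒system-⊆ : ∀ {R S} → IsSystem R → IsSystem S →
                     (∀ j → Holds (R o j) → Holds (S o j)) →
                     ∀ i j → Holds (R i j) → Holds (S i j)
  block-⊆⇒system-⊆ {R} {S} sysR sysS R⊆S i j Rij with transitive i o
  ... | g , g∈L , gi≡o = subst₂ (λ a b → Holds (S a b)) g⁻¹o≡i (inverseˡ g) Sg⁻¹
    where
    Rogj : Holds (R o (g ⟨$⟩ʳ j))
    Rogj = subst (λ a → Holds (R a (g ⟨$⟩ʳ j))) gi≡o (system-invariant sysR g g∈L i j Rij)
    Sg⁻¹ : Holds (S (flip g ⟨$⟩ʳ o) (flip g ⟨$⟩ʳ (g ⟨$⟩ʳ j)))
    Sg⁻¹ = system-invariant sysS (flip g) (inv-∈ L g∈L) o (g ⟨$⟩ʳ j) (R⊆S _ Rogj)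
    g⁻¹o≡i : flip g ⟨$⟩ʳ o ≡ i
    g⁻¹o≡i = trans (cong (flip g ⟨$⟩ʳ_) (sym gi≡o)) (inverseˡ g)

  block-ext : ∀ {R S} → IsSystem R → IsSystem S → (∀ j → R o j ≡ S o j) → ∀ i j → R i j ≡ S i j
  block-ext sysR sysS sameBlock i j =
    bool-ext (block-⊆⇒system-⊆ sysR sysS (λ j Roj → trans (sym (sameBlock j)) Roj) i j)
             (block-⊆⇒system-⊆ sysS sysR (λ j Soj → trans (sameBlock j) Soj) i j)

  -- For g ∈ L with
  -- g o = y, the translate g(R o) ⊆ R y is disjoint from R o, and both lie in R' o.
  block-doubling : ∀ {R R'} → IsSystem R → IsSystem R' → (∀ i j → Holds (R i j) → Holds (R' i j)) →
                   ∀ y → Holds (R' o y) → R o y ≡ false → 2 * count (R o) ≤ count (R' o)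
  block-doubling {R} {R'} sysR sysR' R⊆R' y R'oy Roy≡false with transitive o y
  ... | g , g∈L , go≡y = begin
      2 * count (R o)                           ≡⟨ cong (count (R o) +_) (+-identityʳ (count (R o))) ⟩
      count (R o) + count (R o)                 ≤⟨ +-monoʳ-≤ (count (R o)) (count-mono translate) ⟩
      count (R o) + count (λ j → R y (g ⟨$⟩ʳ j)) ≡⟨ cong (count (R o) +_) (count-perm (R y) g) ⟩
      count (R o) + count (R y)                 ≤⟨ count-disjoint (R o) (R y) disjoint ⟩
      count (λ j → R o j ∨ R y j)               ≤⟨ count-mono union⊆R'o ⟩
      count (R' o)                              ∎
    where
    open ≤-Reasoning
    translate : ∀ j → Holds (R o j) → Holds (R y (g ⟨$⟩ʳ j))
    translate j Roj = subst (λ a → Holds (R a (g ⟨$⟩ʳ j))) go≡y (system-invariant sysR g g∈L o j Roj)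
    disjoint : ∀ j → Holds (R o j) → R y j ≡ false
    disjoint j Roj with R y j in Ryj
    ... | false = refl
    ... | true  with () ← trans (sym Roy≡false) (system-trans sysR o j y Roj (system-sym sysR y j Ryj))
    union⊆R'o : ∀ j → Holds (R o j ∨ R y j) → Holds (R' o j)
    union⊆R'o j _   with R o j in Roj | R y j in Ryj
    ... | true  | _    = R⊆R' o j Roj
    ... | false | true = system-trans sysR' o y j R'oy (R⊆R' y j Ryj)

  contains : BRel ℓ → List (Fin ℓ) → Bool
  contains R x = all (R o) x

  contains-++ˡ : ∀ R x z → Holds (contains R (x ++ z)) → Holds (contains R x)
  contains-++ˡ R []      z _ = refl
  contains-++ˡ R (y ∷ x) z c = cong₂ _∧_ (∧-conicalˡ _ _ c) (contains-++ˡ R x z (∧-conicalʳ _ _ c))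

  contains-++ : ∀ R x z → Holds (contains R x) → Holds (contains R z) → Holds (contains R (x ++ z))
  contains-++ R []      z _  cz = cz
  contains-++ R (y ∷ x) z cx cz = cong₂ _∧_ (∧-conicalˡ _ _ cx) (contains-++ R x z (∧-conicalʳ _ _ cx) cz)

  contains-mem : ∀ R x y → Holds (contains R x) → y ∈ x → Holds (R o y)
  contains-mem R (z ∷ x) y c (here refl) = ∧-conicalˡ _ _ c
  contains-mem R (z ∷ x) y c (there y∈x) = contains-mem R x y (∧-conicalʳ _ _ c) y∈x

  -- The base point itself lies in every block at o, so it can pad tuples.
  contains-padding : ∀ R → IsSystem R → ∀ m → Holds (contains R (toList (replicate m o)))
  contains-padding R sysR zero    = refl
  contains-padding R sysR (suc m) = cong₂ _∧_ (system-refl sysR o) (contains-padding R sysR m)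

  hull : List (BRel ℓ) → List (Fin ℓ) → BRel ℓ
  hull []       x i j = true
  hull (R ∷ Rs) x i j = (contains R x ⇒ᵇ R i j) ∧ hull Rs x i j

  Selected⇒ : List (Fin ℓ) → Fin ℓ → Fin ℓ → BRel ℓ → Set
  Selected⇒ x i j R = Holds (contains R x) → Holds (R i j)

  hull-intro : ∀ Rs x i j → All (Selected⇒ x i j) Rs → Holds (hull Rs x i j)
  hull-intro []       x i j []         = refl
  hull-intro (R ∷ Rs) x i j (Rij ∷ rest) = cong₂ _∧_ (⇒ᵇ-intro (contains R x) Rij) (hull-intro Rs x i j rest)

  hull-elim : ∀ Rs x i j → Holds (hull Rs x i j) → All (Selected⇒ x i j) Rs
  hull-elim []       x i j _ = []
  hull-elim (R ∷ Rs) x i j h =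
    ⇒ᵇ-elim (contains R x) (∧-conicalˡ _ _ h) ∷ hull-elim Rs x i j (∧-conicalʳ _ _ h)

  hull-system : ∀ Rs → All IsSystem Rs → ∀ x → IsSystem (hull Rs x)
  hull-system Rs systems x = (reflexive , symmetric , transitive′) , invariant
    where
    reflexive : ∀ i → Holds (hull Rs x i i)
    reflexive i = hull-intro Rs x i i (All.map (λ sys _ → system-refl sys i) systems)
    symmetric : ∀ i j → Holds (hull Rs x i j) → Holds (hull Rs x j i)
    symmetric i j h = hull-intro Rs x j i
      (All.zipWith (λ (sys , Rij) c → system-sym sys i j (Rij c)) (systems , hull-elim Rs x i j h))
    transitive′ : ∀ i j k → Holds (hull Rs x i j) → Holds (hull Rs x j k) → Holds (hull Rs x i k)
    transitive′ i j k h h′ = hull-intro Rs x i k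
      (All.zipWith (λ (sys , Rij , Rjk) c → system-trans sys i j k (Rij c) (Rjk c))
        (systems , All.zipWith (λ p → p) (hull-elim Rs x i j h , hull-elim Rs x j k h′)))
    invariant : ∀ g → _∈L L g → ∀ i j → Holds (hull Rs x i j) →
                Holds (hull Rs x (g ⟨$⟩ʳ i) (g ⟨$⟩ʳ j))
    invariant g g∈L i j h = hull-intro Rs x _ _
      (All.zipWith (λ (sys , Rij) c → system-invariant sys g g∈L i j (Rij c)) (systems , hull-elim Rs x i j h))

  hull-⊆ : ∀ Rs x R → R ∈ Rs → Holds (contains R x) → ∀ i j → Holds (hull Rs x i j) → Holds (R i j)
  hull-⊆ Rs x R R∈Rs c i j h = All.lookup (hull-elim Rs x i j h) R∈Rs c

  -- Extending the point list selects fewer systems, so the hull grows.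
  hull-++ : ∀ Rs x z i j → Holds (hull Rs x i j) → Holds (hull Rs (x ++ z) i j)
  hull-++ Rs x z i j h =
    hull-intro Rs (x ++ z) i j (All.map (λ {R} Rij c → Rij (contains-++ˡ R x z c)) (hull-elim Rs x i j h))

  hull-mem : ∀ Rs x y → y ∈ x → Holds (hull Rs x o y)
  hull-mem Rs x y y∈x = hull-intro Rs x o y (All.universal (λ R c → contains-mem R x y c y∈x) Rs)

  module Generation (Rs : List (BRel ℓ)) (systems : All IsSystem Rs) (R : BRel ℓ) (R∈Rs : R ∈ Rs) where

    sysR : IsSystem R
    sysR = All.lookup systems R∈Rs

    Generates : List (Fin ℓ) → Set
    Generates x = ∀ j → hull Rs x o j ≡ R o j

    Missing : List (Fin ℓ) → Fin ℓ → Set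
    Missing x y = Holds (R o y) × hull Rs x o y ≡ false

    missing? : ∀ x y → Dec (Missing x y)
    missing? x y with R o y | hull Rs x o y
    ... | true  | false = yes (refl , refl)
    ... | true  | true  = no (λ { (_ , ()) })
    ... | false | _     = no (λ { (() , _) })

    saturated : ∀ x z → Holds (contains R (x ++ z)) → ¬ ∃ (Missing x) → Generates (x ++ z)
    saturated x z c nothingMissing j = bool-ext (hull-⊆ Rs (x ++ z) R R∈Rs c o j) fromR
      where
      fromR : Holds (R o j) → Holds (hull Rs (x ++ z) o j)
      fromR Roj with hull Rs x o j in h
      ... | true  = hull-++ Rs x z o j h
      ... | false = ⊥-elim (nothingMissing (j , Roj , h))

    add-missing : ∀ x y → Holds (contains R x) → Missing x y →
                  Holds (contains R (x ++ [ y ])) ×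
                  2 * count (hull Rs x o) ≤ count (hull Rs (x ++ [ y ]) o)
    add-missing x y c (Roy , missed) =
      contains-++ R x [ y ] c (cong₂ _∧_ Roy refl) ,
      block-doubling (hull-system Rs systems x) (hull-system Rs systems (x ++ [ y ]))
                     (hull-++ Rs x [ y ]) y (hull-mem Rs (x ++ [ y ]) y (∈-++⁺ʳ x (here refl))) missed

    missing-doubles : ∀ x y → Holds (contains R x) → Missing x y → 2 * count (hull Rs x o) ≤ count (R o)
    missing-doubles x y c (Roy , missed) =
      block-doubling (hull-system Rs systems x) sysR (hull-⊆ Rs x R R∈Rs c) y Roy missed

    -- Greedy generation: while the hull's block is larger than ℓ / 2 ^ (m + 1),
    -- at most m further points are needed to generate R.
    generate : ∀ m x → Holds (contains R x) → ℓ < count (hull Rs x o) * 2 ^ suc m →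
               Σ (Vec (Fin ℓ) m) (λ ys → Generates (x ++ toList ys))
    generate m x c large with any? (missing? x)
    ... | no complete =
      replicate m o , saturated x _ (contains-++ R x _ c (contains-padding R sysR m)) complete
    generate zero x c large | yes (y , missing) = ⊥-elim (<⇒≱ ℓ<|Ro| (count-≤ (R o)))
      where
      -- impossible: R's block would have more than ℓ points
      ℓ<|Ro| : ℓ < count (R o)
      ℓ<|Ro| = subst (ℓ <_) (*-identityʳ _)
                 (doubling-invariant {a = count (hull Rs x o)} large (missing-doubles x y c missing))
    generate (suc m) x c large | yes (y , missing)
      with c′ , doubled ← add-missing x y c missing
      with ys , generates ← generate m (x ++ [ y ]) c′
                                  (doubling-invariant {a = count (hull Rs x o)} large doubled)
      = y ∷ᵛ ys , subst Generates (++-assoc x [ y ] (toList ys)) generates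

  -- If ℓ < 2 ^ (k + 1), every system R ∈ Rs is generated by k points: start
  -- greedy generation from the empty list, whose hull has a nonempty block.
  generated-by : ∀ k → ℓ < 2 ^ suc k → (Rs : List (BRel ℓ)) (systems : All IsSystem Rs) →
                 ∀ R (R∈Rs : R ∈ Rs) →
                 Σ (Vec (Fin ℓ) k) (λ ys → Generation.Generates Rs systems R R∈Rs (toList ys))
  generated-by k ℓ<2^[1+k] Rs systems R R∈Rs = Generation.generate Rs systems R R∈Rs k [] refl large
    where
    open ≤-Reasoning
    large : ℓ < count (hull Rs [] o) * 2 ^ suc k
    large = <-≤-trans ℓ<2^[1+k] (begin
      2 ^ suc k                         ≡⟨ sym (*-identityˡ _) ⟩
      1 * 2 ^ suc k                     ≤⟨ *-monoˡ-≤ _ (count-pos _ o (system-refl (hull-system Rs systems []) o)) ⟩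
      count (hull Rs [] o) * 2 ^ suc k  ∎)

  -- Hence a list of pairwise different systems has at most ℓ ^ k members:
  -- code each system by its generating k-tuple.
  systems-bound : ∀ k → ℓ < 2 ^ suc k → (Rs : List (BRel ℓ)) → All IsSystem Rs →
                  AllPairs DifferentB Rs → length Rs ≤ ℓ ^ k
  systems-bound k ℓ<2^[1+k] Rs systems different =
    pairwise-bound Rs different (λ i → encode (generators i)) separated
    where
    sys : ∀ i → IsSystem (lookup Rs i)
    sys i = All.lookup systems (∈-lookup i)
    generated : ∀ i → Σ (Vec (Fin ℓ) k) (λ ys → Generation.Generates Rs systems (lookup Rs i) (∈-lookup i) (toList ys))
    generated i = generated-by k ℓ<2^[1+k] Rs systems (lookup Rs i) (∈-lookup i)
    generators : ∀ i → Vec (Fin ℓ) k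
    generators i = proj₁ (generated i)
    separated : ∀ i j → encode (generators i) ≡ encode (generators j) →
                ¬ DifferentB (lookup Rs i) (lookup Rs j)
    separated i j same (a , b , differ) = differ (block-ext (sys i) (sys j) sameBlock a b)
      where
      sameBlock : ∀ y → lookup Rs i o y ≡ lookup Rs j o y
      sameBlock y = begin
        lookup Rs i o y                            ≡⟨ sym (proj₂ (generated i) y) ⟩
        hull Rs (toList (generators i)) o y        ≡⟨ cong (λ ys → hull Rs (toList ys) o y)
                                                           (encode-injective _ _ same) ⟩
        hull Rs (toList (generators j)) o y        ≡⟨ proj₂ (generated j) y ⟩
        lookup Rs j o y                            ∎
        where open ≡-Reasoning

lemma4p1 : (ℓ : ℕ) → 1 ≤ ℓ → (L : PermGroup ℓ) → Transitive L → AtMostPowLog2Systems L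
lemma4p1 (suc n) _ L transitive Rs systems different with k , 2^k≤ℓ , ℓ<2^[1+k] ← floor-log₂ n =
  atMostPowLog2-from (length Rs) (suc n) k
    (systems-bound k ℓ<2^[1+k] Rs systems different) 2^k≤ℓ
  where open BlockSystems L transitive fzero
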